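{- Let $n>1$ be an integer with prime factorization $n=p_1^{a_1}p_2^{a_2}\cdots p_k^{a_k}$, where the $p_i$ are distinct primes and each $a_i\ge 1$. Let $L_n$ be the divisibility lattice of $n$. Then $D(L_n)=1$ if $a_1,\dots,a_k$ are distinct, and $D(L_n)=2$ otherwise.
   Context: The divisibility lattice $L_n$ is the poset of positive divisors of $n$ ordered by divisibility. A coloring of a poset is distinguishing if the only color-preserving automorphism is the identity; $D(P)$ is the least number of colors in a distinguishing coloring of $P$. -}

module Defs where

open import Data.Nat using (ℕ; zero; suc; _*_; _^_; _≤_)
open import Data.Nat.Divisibility using (_∣_)
open import Data.Fin using (Fin; zero; suc)
open import Data.Product using (Σ; _×_; proj₁; ∃)
open import Relation.Binary.PropositionalEquality using (_≡_)
open import Function.Bundles using (_⇔_)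

prodFin : (k : ℕ) → (Fin k → ℕ) → ℕ
prodFin zero    f = 1
prodFin (suc k) f = f zero * prodFin k (λ i → f (suc i))

-- elements of the divisibility lattice L_n : positive divisors of n
-- (for n ≥ 1 every divisor is positive); equality is on the underlying number
Div : ℕ → Set
Div n = Σ ℕ (λ d → d ∣ n)

IsAut : (n : ℕ) → (Div n → Div n) → Set
IsAut n f =
  (Σ (Div n → Div n) λ g →
     (∀ x → proj₁ (g (f x)) ≡ proj₁ x) × (∀ x → proj₁ (f (g x)) ≡ proj₁ x))
  × (∀ x y → (proj₁ x ∣ proj₁ y) ⇔ (proj₁ (f x) ∣ proj₁ (f y)))

-- a coloring of L_n with c colors (colors of non-divisors are irrelevant;
-- using ℕ as domain makes the coloring automatically well defined on divisors)
Coloring : ℕ → Set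
Coloring c = ℕ → Fin c

Distinguishing : (n c : ℕ) → Coloring c → Set
Distinguishing n c χ =
  ∀ (f : Div n → Div n) → IsAut n f →
    (∀ x → χ (proj₁ (f x)) ≡ χ (proj₁ x)) →
    ∀ x → proj₁ (f x) ≡ proj₁ x

HasDistColoring : ℕ → ℕ → Set
HasDistColoring n c = Σ (Coloring c) (Distinguishing n c)

DistNum : ℕ → ℕ → Set
DistNum n m = HasDistColoring n m × (∀ c → HasDistColoring n c → m ≤ c)

module Submission where

-- The divisors of n = p₁^a₁ ⋯ p_k^a_k, ordered by divisibility, form the lattice
-- L_n ≅ [0,a₁] × ⋯ × [0,a_k]; a divisor d corresponds to its exponent vector
-- (ν₁ d , … , ν_k d).
--
-- An order automorphism F of L_n sends primes (the atoms) to primes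
--   and divisors whose divisors form a chain to such divisors, i.e. prime powers
--   to prime powers; by induction on e, F(p_i) = p_j forces F(p_i^e) = p_j^e,
--   hence a_i = a_j.  A divisor is determined by the prime powers below it, so an
--   automorphism fixing every prime is the identity.  With distinct exponents every
--   automorphism therefore fixes the primes, and one color suffices.
-- * Symmetry.  If a_i = a_j with i ≠ j, swapping the exponents of p_i and p_j is a
--   nontrivial automorphism, so one color does not suffice.
-- * A 2-coloring.  Color black the chain of primorials 1 ∣ p₁ ∣ p₁p₂ ∣ ⋯ ∣ p₁⋯p_k.
--   A color-preserving automorphism maps this chain onto itself, hence fixes it
--   pointwise; since p_i lies below the i-th primorial but not below the (i-1)-th,
--   it also fixes every prime, and is the identity by rigidity.

open import Defs
open import Data.Nat using (ℕ; zero; suc; _*_; _^_; _<_; _≤_; z≤n; s≤s; NonZero;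
  nonTrivial⇒n>1; n>1⇒nonTrivial; ≢-nonZero; ≢-nonZero⁻¹; >-nonZero⁻¹)
open import Data.Nat.Properties
open import Data.Nat.Divisibility
open import Data.Nat.Induction using (<-rec)
open import Data.Nat.Coprimality using (Coprime; coprime-divisor)
open import Data.Nat.Primality using (Prime; Irreducible; euclidsLemma; prime⇒irreducible; irreducible⇒prime;
  prime⇒nonZero; prime⇒nonTrivial)
open import Data.Nat.Primality.Factorisation using (factorise)
open import Data.Fin using (Fin; zero; suc; toℕ)
import Data.Fin.Properties as Fin
open import Data.Fin.Permutation using (Permutation; _⟨$⟩ʳ_; _⟨$⟩ˡ_; flip; inverseˡ; inverseʳ; transpose)
open import Data.List using ([]; _∷_)
open import Data.List.Relation.Unary.All using (_∷_)
open import Data.Product using (Σ; _×_; _,_; proj₁; proj₂; ∃)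
open import Data.Sum using (_⊎_; inj₁; inj₂)
open import Data.Empty using (⊥-elim)
open import Function using (_∘_)
open import Function.Bundles using (Equivalence; mk⇔)
open import Relation.Binary.PropositionalEquality
open import Relation.Nullary using (¬_; yes; no; Dec)
open import Relation.Nullary.Decidable using (_→-dec_; decidable-stable)
open import Relation.Nullary.Negation using (contradiction)

prime>1 : ∀ {p} → Prime p → 1 < p
prime>1 {p} pp = nonTrivial⇒n>1 p {{prime⇒nonTrivial pp}}

prime∤1 : ∀ {p} → Prime p → ¬ p ∣ 1
prime∤1 pp p∣1 = <⇒≢ (prime>1 pp) (sym (∣1⇒≡1 p∣1))

divisor-nonZero : ∀ {d n} .{{_ : NonZero n}} → d ∣ n → NonZero d
divisor-nonZero {n = n} d∣n = ≢-nonZero λ { refl → ≢-nonZero⁻¹ n (0∣⇒≡0 d∣n) }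

prime∣prime⇒≡ : ∀ {q p} → Prime q → Prime p → q ∣ p → q ≡ p
prime∣prime⇒≡ pq pp q∣p with prime⇒irreducible pp q∣p
... | inj₁ refl = ⊥-elim (prime∤1 pq ∣-refl)
... | inj₂ q≡p = q≡p

prime∣^⇒∣ : ∀ {q p} e → Prime q → q ∣ p ^ e → q ∣ p
prime∣^⇒∣ zero    pq q∣1 = ⊥-elim (prime∤1 pq q∣1)
prime∣^⇒∣ {p = p} (suc e) pq q∣p^1+e with euclidsLemma p (p ^ e) pq q∣p^1+e
... | inj₁ q∣p   = q∣p
... | inj₂ q∣p^e = prime∣^⇒∣ e pq q∣p^e

∃prime∣ : ∀ d → 1 < d → ∃ λ q → Prime q × q ∣ d
∃prime∣ 1 (s≤s ())
∃prime∣ d@(suc (suc _)) _ with factorise d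
... | record { factors = [] ; isFactorisation = () }
... | record { factors = q ∷ _ ; isFactorisation = d≡∏ ; factorsPrime = pq ∷ _ } =
  q , pq , subst (q ∣_) (sym d≡∏) (m∣m*n _)

^-mono-∣ : ∀ p {e c} → e ≤ c → p ^ e ∣ p ^ c
^-mono-∣ p {zero}  {c}     _         = 1∣ (p ^ c)
^-mono-∣ p {suc e} {suc c} (s≤s e≤c) = *-monoʳ-∣ p (^-mono-∣ p e≤c)

^-∣-reflects-≤ : ∀ {p e c} → Prime p → p ^ e ∣ p ^ c → e ≤ c
^-∣-reflects-≤ {p} {e} {c} pp p^e∣p^c with e ≤? c
... | yes e≤c = e≤c
... | no  e≰c = contradiction (∣⇒≤ {{m^n≢0 p c {{prime⇒nonZero pp}}}} p^e∣p^c)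
                              (<⇒≱ (^-monoʳ-< p (prime>1 pp) (≰⇒> e≰c)))

prime∤⇒coprime : ∀ {p m} → Prime p → ¬ p ∣ m → Coprime m p
prime∤⇒coprime pp p∤m (c∣m , c∣p) with prime⇒irreducible pp c∣p
... | inj₁ c≡1 = c≡1
... | inj₂ refl = ⊥-elim (p∤m c∣m)

∣p^⇒≡p^ : ∀ {p d} e → Prime p → d ∣ p ^ e → ∃ λ f → f ≤ e × d ≡ p ^ f
∣p^⇒≡p^ zero pp d∣1 = 0 , z≤n , ∣1⇒≡1 d∣1
∣p^⇒≡p^ {p} {d} (suc e) pp d∣p^1+e with p ∣? d
... | no p∤d =
  let f , f≤e , d≡p^f = ∣p^⇒≡p^ e pp (coprime-divisor (prime∤⇒coprime pp p∤d) d∣p^1+e)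
  in  f , m≤n⇒m≤1+n f≤e , d≡p^f
... | yes (divides d' refl) =
  let d'∣p^e = *-cancelʳ-∣ p {{prime⇒nonZero pp}} (subst (d' * p ∣_) (*-comm p (p ^ e)) d∣p^1+e)
      f , f≤e , d'≡p^f = ∣p^⇒≡p^ e pp d'∣p^e
  in  suc f , s≤s f≤e , trans (*-comm d' p) (cong (p *_) d'≡p^f)

prime∤⇒coprime^ : ∀ {p m} e → Prime p → ¬ p ∣ m → Coprime (p ^ e) m
prime∤⇒coprime^ e pp p∤m (c∣p^e , c∣m) with ∣p^⇒≡p^ e pp c∣p^e
... | zero  , _ , c≡1  = c≡1
... | suc f , _ , refl = ⊥-elim (p∤m (∣-trans (m∣m*n _) c∣m))

-- Chain d: the divisors of d are totally ordered by divisibility.  Powers of a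
-- prime are chains; in L_n these are the only ones (see chain⇒prime-power).
Chain : ℕ → Set
Chain d = ∀ y z → y ∣ d → z ∣ d → y ∣ z ⊎ z ∣ y

^-chain : ∀ {p} e → Prime p → Chain (p ^ e)
^-chain {p} e pp y z y∣p^e z∣p^e with ∣p^⇒≡p^ e pp y∣p^e | ∣p^⇒≡p^ e pp z∣p^e
... | f , _ , refl | g , _ , refl with ≤-total f g
...   | inj₁ f≤g = inj₁ (^-mono-∣ p f≤g)
...   | inj₂ g≤f = inj₂ (^-mono-∣ p g≤f)

coprime-*∣ : ∀ {u v m} → Coprime u v → u ∣ m → v ∣ m → u * v ∣ m
coprime-*∣ {u} {v} cop u∣m (divides t refl) =
  *-monoˡ-∣ v (coprime-divisor cop (subst (u ∣_) (*-comm t v) u∣m))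

record DistinctPrimes (k : ℕ) (p : Fin k → ℕ) : Set where
  field
    isPrime   : ∀ i → Prime (p i)
    injective : ∀ i j → p i ≡ p j → i ≡ j

tailPrimes : ∀ {k p} → DistinctPrimes (suc k) p → DistinctPrimes k (p ∘ suc)
tailPrimes dp = record
  { isPrime   = isPrime ∘ suc
  ; injective = λ i j pi≡pj → Fin.suc-injective (injective (suc i) (suc j) pi≡pj) }
  where open DistinctPrimes dp

index-∣ : ∀ {k p} → DistinctPrimes k p → ∀ {i j} → p i ∣ p j → i ≡ j
index-∣ dp {i} {j} pi∣pj = injective i j (prime∣prime⇒≡ (isPrime i) (isPrime j) pi∣pj)
  where open DistinctPrimes dp

prodPow : (k : ℕ) → (Fin k → ℕ) → (Fin k → ℕ) → ℕ
prodPow k p c = prodFin k (λ i → p i ^ c i)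

prodPow-nonZero : ∀ {k p} c → (∀ i → Prime (p i)) → NonZero (prodPow k p c)
prodPow-nonZero {zero}      c prime = _
prodPow-nonZero {suc k} {p} c prime =
  m*n≢0 (p zero ^ c zero) (prodPow k (p ∘ suc) (c ∘ suc))
    {{m^n≢0 (p zero) (c zero) {{prime⇒nonZero (prime zero)}}}}
    {{prodPow-nonZero (c ∘ suc) (prime ∘ suc)}}

prime∣prodPow : ∀ {k p q} c → (∀ i → Prime (p i)) → Prime q → q ∣ prodPow k p c → ∃ λ i → q ≡ p i
prime∣prodPow {zero}      c prime pq q∣1 = ⊥-elim (prime∤1 pq q∣1)
prime∣prodPow {suc k} {p} c prime pq q∣∏
  with euclidsLemma (p zero ^ c zero) (prodPow k (p ∘ suc) (c ∘ suc)) pq q∣∏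
... | inj₁ q∣head = zero , prime∣prime⇒≡ pq (prime zero) (prime∣^⇒∣ (c zero) pq q∣head)
... | inj₂ q∣tail = let i , q≡pi = prime∣prodPow (c ∘ suc) (prime ∘ suc) pq q∣tail in suc i , q≡pi

^∣prodPow : ∀ {k} p c i {e} → e ≤ c i → p i ^ e ∣ prodPow k p c
^∣prodPow p c zero    e≤c0 = ∣-trans (^-mono-∣ (p zero) e≤c0) (m∣m*n _)
^∣prodPow p c (suc i) e≤ci = ∣-trans (^∣prodPow (p ∘ suc) (c ∘ suc) i e≤ci) (n∣m*n (p zero ^ c zero))

prodPow-mono : ∀ {k} p {c c'} → (∀ i → c i ≤ c' i) → prodPow k p c ∣ prodPow k p c'
prodPow-mono {zero}  p c≤c' = ∣-refl
prodPow-mono {suc k} p c≤c' = *-pres-∣ (^-mono-∣ (p zero) (c≤c' zero)) (prodPow-mono (p ∘ suc) (c≤c' ∘ suc))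

prodPow-cong : ∀ {k} p {c c'} → (∀ i → c i ≡ c' i) → prodPow k p c ≡ prodPow k p c'
prodPow-cong {zero}  p c≡c' = refl
prodPow-cong {suc k} p c≡c' = cong₂ _*_ (cong (p zero ^_) (c≡c' zero)) (prodPow-cong (p ∘ suc) (c≡c' ∘ suc))

head∤tail : ∀ {k p} → DistinctPrimes (suc k) p → ∀ c → ¬ p zero ∣ prodPow k (p ∘ suc) c
head∤tail dp c p0∣tail with prime∣prodPow c (isPrime ∘ suc) (isPrime zero) p0∣tail
  where open DistinctPrimes dp
... | j , p0≡pj with DistinctPrimes.injective dp zero (suc j) p0≡pj
...   | ()

^∣prodPow⇒≤ : ∀ {k p} → DistinctPrimes k p → ∀ c i e → p i ^ e ∣ prodPow k p c → e ≤ c i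
^∣prodPow⇒≤ {suc k} {p} dp c zero e p0^e∣∏ =
  ^-∣-reflects-≤ (isPrime zero)
    (coprime-divisor (prime∤⇒coprime^ e (isPrime zero) (head∤tail dp (c ∘ suc)))
      (subst (p zero ^ e ∣_) (*-comm (p zero ^ c zero) _) p0^e∣∏))
  where open DistinctPrimes dp
^∣prodPow⇒≤ {suc k} {p} dp c (suc i) e pi^e∣∏ =
  ^∣prodPow⇒≤ (tailPrimes dp) (c ∘ suc) i e
    (coprime-divisor (prime∤⇒coprime^ e (isPrime (suc i)) pi∤head) pi^e∣∏)
  where
  open DistinctPrimes dp
  pi∤head : ¬ p (suc i) ∣ p zero ^ c zero
  pi∤head pi∣head with index-∣ dp (prime∣^⇒∣ (c zero) (isPrime (suc i)) pi∣head)
  ... | ()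

prodPow-∣ : ∀ {k p} → DistinctPrimes k p → ∀ c {m} → (∀ i → p i ^ c i ∣ m) → prodPow k p c ∣ m
prodPow-∣ {zero}      dp c {m} _     = 1∣ m
prodPow-∣ {suc k} {p} dp c       p^c∣m =
  coprime-*∣ (prime∤⇒coprime^ (c zero) (isPrime zero) (head∤tail dp (c ∘ suc)))
             (p^c∣m zero) (prodPow-∣ (tailPrimes dp) (c ∘ suc) (p^c∣m ∘ suc))
  where open DistinctPrimes dp

maxExp : ℕ → ℕ → ℕ → ℕ
maxExp q d zero    = 0
maxExp q d (suc c) with q ^ suc c ∣? d
... | yes _ = suc c
... | no  _ = maxExp q d c

maxExp-≤ : ∀ q d c → maxExp q d c ≤ c
maxExp-≤ q d zero    = z≤n
maxExp-≤ q d (suc c) with q ^ suc c ∣? d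
... | yes _ = ≤-refl
... | no  _ = m≤n⇒m≤1+n (maxExp-≤ q d c)

maxExp-∣ : ∀ q d c → q ^ maxExp q d c ∣ d
maxExp-∣ q d zero    = 1∣ d
maxExp-∣ q d (suc c) with q ^ suc c ∣? d
... | yes q^c∣d = q^c∣d
... | no  _     = maxExp-∣ q d c

maxExp-max : ∀ {q d c e} → e ≤ c → q ^ e ∣ d → e ≤ maxExp q d c
maxExp-max {q} {d} {zero}  e≤0 _ = e≤0
maxExp-max {q} {d} {suc c} {e} e≤1+c q^e∣d with q ^ suc c ∣? d
... | yes _ = e≤1+c
... | no q^1+c∤d with m≤n⇒m<n∨m≡n e≤1+c
...   | inj₁ (s≤s e≤c) = maxExp-max e≤c q^e∣d
...   | inj₂ refl      = contradiction q^e∣d q^1+c∤d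

module Divisors {k p} (dp : DistinctPrimes k p) (a : Fin k → ℕ) where
  open DistinctPrimes dp

  n : ℕ
  n = prodPow k p a

  instance
    n-nonZero : NonZero n
    n-nonZero = prodPow-nonZero a isPrime

  -- ν i d: the exponent of p_i in d (searched up to a_i, enough for divisors of n).
  ν : Fin k → ℕ → ℕ
  ν i d = maxExp (p i) d (a i)

  ν-≤ : ∀ i d → ν i d ≤ a i
  ν-≤ i d = maxExp-≤ (p i) d (a i)

  ν-∣ : ∀ i d → p i ^ ν i d ∣ d
  ν-∣ i d = maxExp-∣ (p i) d (a i)

  ν-max : ∀ {d} i e → d ∣ n → p i ^ e ∣ d → e ≤ ν i d
  ν-max i e d∣n pi^e∣d = maxExp-max (^∣prodPow⇒≤ dp a i e (∣-trans pi^e∣d d∣n)) pi^e∣d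

  ν-mono : ∀ i {d d'} → d ∣ d' → ν i d ≤ ν i d'
  ν-mono i {d} d∣d' = maxExp-max (ν-≤ i d) (∣-trans (ν-∣ i d) d∣d')

  ν-prodPow : ∀ c → (∀ i → c i ≤ a i) → ∀ i → ν i (prodPow k p c) ≡ c i
  ν-prodPow c c≤a i = ≤-antisym (^∣prodPow⇒≤ dp c i _ (ν-∣ i (prodPow k p c)))
                                (maxExp-max (c≤a i) (^∣prodPow p c i ≤-refl))

  νPart : ℕ → ℕ
  νPart d = prodPow k p (λ i → ν i d)

  -- No prime divides d / νPart d: it would be some p_i and raise the exponent ν i d.
  cofactor-no-prime : ∀ {d q r} → d ∣ n → d ≡ q * νPart d → Prime r → ¬ r ∣ q
  cofactor-no-prime {d} {q} d∣n d≡q*P pr r∣q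
    with prime∣prodPow a isPrime pr (∣-trans r∣q (∣-trans (divides (νPart d) (trans d≡q*P (*-comm q _))) d∣n))
  ... | i , refl = <-irrefl refl (ν-max i (suc (ν i d)) d∣n (subst (p i ^ suc (ν i d) ∣_) (sym d≡q*P)
                                                  (*-pres-∣ r∣q (^∣prodPow p (λ l → ν l d) i ≤-refl))))

  factorisation : ∀ {d} → d ∣ n → d ≡ νPart d
  factorisation {d} d∣n with prodPow-∣ dp (λ i → ν i d) (λ i → ν-∣ i d)
  ... | divides zero d≡0 = contradiction (0∣⇒≡0 (subst (_∣ n) d≡0 d∣n)) (≢-nonZero⁻¹ n)
  ... | divides 1    d≡P = trans d≡P (*-identityˡ _)
  ... | divides q@(suc (suc _)) d≡q*P =
    let r , pr , r∣q = ∃prime∣ q (s≤s (s≤s z≤n)) in ⊥-elim (cofactor-no-prime d∣n d≡q*P pr r∣q)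

  divisor-test : ∀ {d m} → d ∣ n → (∀ i e → p i ^ e ∣ d → p i ^ e ∣ m) → d ∣ m
  divisor-test {d} {m} d∣n test =
    subst (_∣ m) (sym (factorisation d∣n)) (prodPow-∣ dp (λ l → ν l d) (λ i → test i (ν i d) (ν-∣ i d)))

  ν-reflects : ∀ {d d'} → d ∣ n → (∀ i → ν i d ≤ ν i d') → d ∣ d'
  ν-reflects {d} {d'} d∣n ν≤ν' = divisor-test d∣n λ i e pi^e∣d →
    ∣-trans (^-mono-∣ (p i) (≤-trans (ν-max i e d∣n pi^e∣d) (ν≤ν' i))) (ν-∣ i d')

  -- A chain divisor of n divisible by p_j is a power of p_j: no other p_i can divide
  -- it, since p_i and p_j are incomparable.
  chain⇒prime-power : ∀ {d} j → d ∣ n → Chain d → p j ∣ d → ∃ λ f → d ≡ p j ^ f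
  chain⇒prime-power {d} j d∣n chain pj∣d =
    let f , _ , d≡pj^f = ∣p^⇒≡p^ (a j) (isPrime j) (divisor-test d∣n only-pj) in f , d≡pj^f
    where
    only-pj : ∀ i e → p i ^ e ∣ d → p i ^ e ∣ p j ^ a j
    only-pj i e pi^e∣d with i Fin.≟ j
    ... | yes refl = ^-mono-∣ (p i) (^∣prodPow⇒≤ dp a i e (∣-trans pi^e∣d d∣n))
    only-pj i zero    _      | no i≢j = 1∣ _
    only-pj i (suc e) pi^e∣d | no i≢j with chain (p i) (p j) (∣-trans (m∣m*n _) pi^e∣d) pj∣d
    ... | inj₁ pi∣pj = contradiction (index-∣ dp pi∣pj) i≢j
    ... | inj₂ pj∣pi = contradiction (sym (index-∣ dp pj∣pi)) i≢j

val : ∀ {n} → Div n → ℕ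
val = proj₁

record Aut (n : ℕ) : Set where
  field
    F F⁻¹     : Div n → Div n
    F⁻¹∘F     : ∀ x → val (F⁻¹ (F x)) ≡ val x
    F∘F⁻¹     : ∀ x → val (F (F⁻¹ x)) ≡ val x
    F-mono    : ∀ x y → val x ∣ val y → val (F x) ∣ val (F y)
    F-reflect : ∀ x y → val (F x) ∣ val (F y) → val x ∣ val y

fromIsAut : ∀ {n} (f : Div n → Div n) → IsAut n f → Aut n
fromIsAut f ((g , g∘f , f∘g) , f-iff) = record
  { F = f ; F⁻¹ = g ; F⁻¹∘F = g∘f ; F∘F⁻¹ = f∘g
  ; F-mono    = λ x y → Equivalence.to (f-iff x y)
  ; F-reflect = λ x y → Equivalence.from (f-iff x y) }

toIsAut : ∀ {n} (A : Aut n) → IsAut n (Aut.F A)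
toIsAut A = (F⁻¹ , F⁻¹∘F , F∘F⁻¹) , λ x y → mk⇔ (F-mono x y) (F-reflect x y)
  where open Aut A

inverse : ∀ {n} → Aut n → Aut n
inverse A = record
  { F = F⁻¹ ; F⁻¹ = F ; F⁻¹∘F = F∘F⁻¹ ; F∘F⁻¹ = F⁻¹∘F
  ; F-mono    = λ x y x∣y → F-reflect (F⁻¹ x) (F⁻¹ y) (subst₂ _∣_ (sym (F∘F⁻¹ x)) (sym (F∘F⁻¹ y)) x∣y)
  ; F-reflect = λ x y F⁻¹x∣F⁻¹y → subst₂ _∣_ (F∘F⁻¹ x) (F∘F⁻¹ y) (F-mono (F⁻¹ x) (F⁻¹ y) F⁻¹x∣F⁻¹y) }
  where open Aut A

module AutProperties {n} (A : Aut n) where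
  open Aut A

  F-cong : ∀ x y → val x ≡ val y → val (F x) ≡ val (F y)
  F-cong x y x≡y = ∣-antisym (F-mono x y (∣-reflexive x≡y)) (F-mono y x (∣-reflexive (sym x≡y)))

  F-injective : ∀ x y → val (F x) ≡ val (F y) → val x ≡ val y
  F-injective x y Fx≡Fy = ∣-antisym (F-reflect x y (∣-reflexive Fx≡Fy)) (F-reflect y x (∣-reflexive (sym Fx≡Fy)))

  F⁻¹-image : ∀ x y → val (F x) ≡ val y → val (F⁻¹ y) ≡ val x
  F⁻¹-image x y Fx≡y = F-injective (F⁻¹ y) x (trans (F∘F⁻¹ y) (sym Fx≡y))

  one : Div n
  one = 1 , 1∣ n

  F-unit : ∀ x → val x ≡ 1 → val (F x) ≡ 1
  F-unit x x≡1 =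
    ∣1⇒≡1 (subst (val (F x) ∣_) (F∘F⁻¹ one) (F-mono x (F⁻¹ one) (subst (_∣ _) (sym x≡1) (1∣ _))))

  pullback : ∀ x {d} → d ∣ val (F x) → Σ (Div n) λ y → val (F y) ≡ d × val y ∣ val x
  pullback x {d} d∣Fx = F⁻¹ y , F∘F⁻¹ y , F-reflect (F⁻¹ y) x (subst (_∣ val (F x)) (sym (F∘F⁻¹ y)) d∣Fx)
    where
    y : Div n
    y = d , ∣-trans d∣Fx (proj₂ (F x))

  F-chain : ∀ x → Chain (val x) → Chain (val (F x))
  F-chain x chain d e d∣Fx e∣Fx with pullback x d∣Fx | pullback x e∣Fx
  ... | y , refl , y∣x | z , refl , z∣x with chain (val y) (val z) y∣x z∣x
  ...   | inj₁ y∣z = inj₁ (F-mono y z y∣z)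
  ...   | inj₂ z∣y = inj₂ (F-mono z y z∣y)

  F-prime : .{{NonZero n}} → ∀ x → Prime (val x) → Prime (val (F x))
  F-prime x px = irreducible⇒prime {{n>1⇒nonTrivial Fx>1}} Fx-irreducible
    where
    Fx≢1 : val (F x) ≢ 1
    Fx≢1 Fx≡1 = prime∤1 px (∣-reflexive (F-injective x one (trans Fx≡1 (sym (F-unit one refl)))))
    Fx>1 : 1 < val (F x)
    Fx>1 = ≤∧≢⇒< (>-nonZero⁻¹ _ {{divisor-nonZero (proj₂ (F x))}})
                 (λ 1≡Fx → Fx≢1 (sym 1≡Fx))
    Fx-irreducible : Irreducible (val (F x))
    Fx-irreducible d∣Fx with pullback x d∣Fx
    ... | y , refl , y∣x with prime⇒irreducible px y∣x
    ...   | inj₁ y≡1 = inj₁ (F-unit y y≡1)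
    ...   | inj₂ y≡x = inj₂ (F-cong y x y≡x)

  -- If F maps a chain B onto itself (in both directions), it fixes B pointwise:
  -- by strong induction on x ∈ B, a strictly smaller F x or F⁻¹ x would already be
  -- fixed, contradicting injectivity.
  fixes-chain : .{{NonZero n}} → (B : ℕ → Set) → (∀ {u v} → B u → B v → u ∣ v ⊎ v ∣ u) →
    (∀ x → B (val x) → B (val (F x))) → (∀ x → B (val x) → B (val (F⁻¹ x))) →
    ∀ x → B (val x) → val (F x) ≡ val x
  fixes-chain B comparable F-B F⁻¹-B x = <-rec P fix (val x) x refl
    where
    P : ℕ → Set
    P m = ∀ x → val x ≡ m → B (val x) → val (F x) ≡ val x
    below : ∀ {d} x → d ∣ val x → d ≢ val x → d < val x
    below x d∣x d≢x = ≤∧≢⇒< (∣⇒≤ {{divisor-nonZero (proj₂ x)}} d∣x) d≢x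
    fix : ∀ m → (∀ {m'} → m' < m → P m') → P m
    fix .(val x) ih x refl bx with comparable (F-B x bx) bx
    ... | inj₁ Fx∣x with val (F x) ≟ val x
    ...   | yes Fx≡x = Fx≡x
    ...   | no  Fx≢x = F-injective (F x) x (ih (below x Fx∣x Fx≢x) (F x) refl (F-B x bx))
    fix .(val x) ih x refl bx | inj₂ x∣Fx = trans (F-cong x (F⁻¹ x) (sym F⁻¹x≡x)) (F∘F⁻¹ x)
      where
      F⁻¹x∣x : val (F⁻¹ x) ∣ val x
      F⁻¹x∣x = F-reflect (F⁻¹ x) x (subst (_∣ val (F x)) (sym (F∘F⁻¹ x)) x∣Fx)
      F⁻¹x≡x : val (F⁻¹ x) ≡ val x
      F⁻¹x≡x with val (F⁻¹ x) ≟ val x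
      ... | yes F⁻¹x≡x = F⁻¹x≡x
      ... | no  F⁻¹x≢x = trans (sym (ih (below x F⁻¹x∣x F⁻¹x≢x) (F⁻¹ x) refl (F⁻¹-B x bx))) (F∘F⁻¹ x)

module Automorphisms {k p} (dp : DistinctPrimes k p) (a : Fin k → ℕ) (apos : ∀ i → 1 ≤ a i) where
  open DistinctPrimes dp
  open Divisors dp a

  power : ∀ i e → e ≤ a i → Div n
  power i e e≤ai = p i ^ e , ^∣prodPow p a i e≤ai

  atom : Fin k → Div n
  atom i = power i 1 (apos i)

  module _ (A : Aut n) where
    open Aut A
    open AutProperties A

    F-atom : ∀ i → ∃ λ j → val (F (atom i)) ≡ p j ^ 1
    F-atom i with prime∣prodPow a isPrime (F-prime (atom i) (subst Prime (sym (^-identityʳ (p i))) (isPrime i)))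
                                (proj₂ (F (atom i)))
    ... | j , Fpi≡pj = j , trans Fpi≡pj (sym (^-identityʳ (p j)))

    -- If F(p_i^{e+1}) = p_j^{e+1}, then p_j^{e+2} ∣ F(p_i^{e+2}): the image is a chain
    -- divisible by p_j, hence a power of p_j, and strictly above p_j^{e+1}.
    F-step : ∀ i j e (1+e≤ai : suc e ≤ a i) (2+e≤ai : suc (suc e) ≤ a i) →
             val (F (power i (suc e) 1+e≤ai)) ≡ p j ^ suc e →
             p j ^ suc (suc e) ∣ val (F (power i (suc (suc e)) 2+e≤ai))
    F-step i j e 1+e≤ai 2+e≤ai Fx≡pj^1+e =
      power-of-pj (chain⇒prime-power j (proj₂ (F y)) (F-chain y (^-chain (suc (suc e)) (isPrime i)))
                                       (∣-trans (m∣m*n _) pj^1+e∣Fy))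
      where
      x y : Div n
      x = power i (suc e) 1+e≤ai
      y = power i (suc (suc e)) 2+e≤ai
      pj^1+e∣Fy : p j ^ suc e ∣ val (F y)
      pj^1+e∣Fy = subst (_∣ val (F y)) Fx≡pj^1+e (F-mono x y (^-mono-∣ (p i) (n≤1+n (suc e))))
      power-of-pj : (∃ λ f → val (F y) ≡ p j ^ f) → p j ^ suc (suc e) ∣ val (F y)
      power-of-pj (f , Fy≡pj^f) = subst (p j ^ suc (suc e) ∣_) (sym Fy≡pj^f) (^-mono-∣ (p j) 2+e≤f)
        where
        1+e≢f : suc e ≢ f
        1+e≢f refl = <-irrefl refl (^-∣-reflects-≤ {e = suc (suc e)} {c = suc e} (isPrime i)
                                       (∣-reflexive (F-injective y x (trans Fy≡pj^f (sym Fx≡pj^1+e)))))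
        2+e≤f : suc (suc e) ≤ f
        2+e≤f = ≤∧≢⇒< (^-∣-reflects-≤ (isPrime j) (subst (p j ^ suc e ∣_) Fy≡pj^f pj^1+e∣Fy)) 1+e≢f

  module _ (A : Aut n) where
    open Aut A
    open AutProperties A

    -- The same argument for F⁻¹ gives the reverse divisibility, so F(p_i^{e+2}) = p_j^{e+2}.
    extend : ∀ i j e (1+e≤ai : suc e ≤ a i) (2+e≤ai : suc (suc e) ≤ a i) →
             val (F (power i (suc e) 1+e≤ai)) ≡ p j ^ suc e × suc e ≤ a j →
             val (F (power i (suc (suc e)) 2+e≤ai)) ≡ p j ^ suc (suc e) × suc (suc e) ≤ a j
    extend i j e 1+e≤ai 2+e≤ai (Fx≡pj^1+e , 1+e≤aj) = ∣-antisym Fy∣pj^2+e pj^2+e∣Fy , 2+e≤aj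
      where
      y : Div n
      y = power i (suc (suc e)) 2+e≤ai
      pj^2+e∣Fy : p j ^ suc (suc e) ∣ val (F y)
      pj^2+e∣Fy = F-step A i j e 1+e≤ai 2+e≤ai Fx≡pj^1+e
      2+e≤aj : suc (suc e) ≤ a j
      2+e≤aj = ^∣prodPow⇒≤ dp a j _ (∣-trans pj^2+e∣Fy (proj₂ (F y)))
      z : Div n
      z = power j (suc (suc e)) 2+e≤aj
      pi^2+e∣F⁻¹z : p i ^ suc (suc e) ∣ val (F⁻¹ z)
      pi^2+e∣F⁻¹z = F-step (inverse A) j i e 1+e≤aj 2+e≤aj (F⁻¹-image (power i (suc e) 1+e≤ai) _ Fx≡pj^1+e)
      Fy∣pj^2+e : val (F y) ∣ p j ^ suc (suc e)
      Fy∣pj^2+e = subst (val (F y) ∣_) (F∘F⁻¹ z) (F-mono y (F⁻¹ z) pi^2+e∣F⁻¹z)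

    F-powers : ∀ i j → val (F (atom i)) ≡ p j ^ 1 →
               ∀ e (e≤ai : e ≤ a i) → val (F (power i e e≤ai)) ≡ p j ^ e × e ≤ a j
    F-powers i j Fpi≡pj zero e≤ai = F-unit (power i 0 e≤ai) refl , z≤n
    F-powers i j Fpi≡pj 1 1≤ai =
      Fpi≡pj' , ^∣prodPow⇒≤ dp a j 1 (subst (_∣ n) Fpi≡pj' (proj₂ (F (power i 1 1≤ai))))
      where
      Fpi≡pj' : val (F (power i 1 1≤ai)) ≡ p j ^ 1
      Fpi≡pj' = trans (F-cong (power i 1 1≤ai) (atom i) refl) Fpi≡pj
    F-powers i j Fpi≡pj (suc (suc e)) 2+e≤ai =
      let 1+e≤ai = ≤-trans (n≤1+n (suc e)) 2+e≤ai
      in  extend i j e 1+e≤ai 2+e≤ai (F-powers i j Fpi≡pj (suc e) 1+e≤ai)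

    -- An automorphism fixing every prime fixes every prime power, hence every divisor.
    rigid : (∀ i → val (F (atom i)) ≡ p i ^ 1) → ∀ x → val (F x) ≡ val x
    rigid F-fixes-atoms x = ∣-antisym (divisor-test (proj₂ (F x)) Fx⇒x) (divisor-test (proj₂ x) x⇒Fx)
      where
      fixes-power : ∀ i e (e≤ai : e ≤ a i) → val (F (power i e e≤ai)) ≡ p i ^ e
      fixes-power i e e≤ai = proj₁ (F-powers i i (F-fixes-atoms i) e e≤ai)
      Fx⇒x : ∀ i e → p i ^ e ∣ val (F x) → p i ^ e ∣ val x
      Fx⇒x i e pi^e∣Fx = F-reflect (power i e e≤ai) x (subst (_∣ val (F x)) (sym (fixes-power i e e≤ai)) pi^e∣Fx)
        where e≤ai = ^∣prodPow⇒≤ dp a i e (∣-trans pi^e∣Fx (proj₂ (F x)))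
      x⇒Fx : ∀ i e → p i ^ e ∣ val x → p i ^ e ∣ val (F x)
      x⇒Fx i e pi^e∣x = subst (_∣ val (F x)) (fixes-power i e e≤ai) (F-mono (power i e e≤ai) x pi^e∣x)
        where e≤ai = ^∣prodPow⇒≤ dp a i e (∣-trans pi^e∣x (proj₂ x))

  -- Applying F-powers to F and F⁻¹: F(p_i) = p_j forces a_i = a_j.
  exponent-preserved : (A : Aut n) → ∀ i j → val (Aut.F A (atom i)) ≡ p j ^ 1 → a i ≡ a j
  exponent-preserved A i j Fpi≡pj =
    ≤-antisym (proj₂ (F-powers A i j Fpi≡pj (a i) ≤-refl))
              (proj₂ (F-powers (inverse A) j i (AutProperties.F⁻¹-image A (atom i) (atom j) Fpi≡pj) (a j) ≤-refl))

  distinct-exponents⇒rigid : (∀ i j → a i ≡ a j → i ≡ j) → (A : Aut n) → ∀ x → val (Aut.F A x) ≡ val x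
  distinct-exponents⇒rigid a-injective A = rigid A F-fixes-atoms
    where
    F-fixes-atoms : ∀ i → val (Aut.F A (atom i)) ≡ p i ^ 1
    F-fixes-atoms i with F-atom A i
    ... | j , Fpi≡pj with a-injective i j (exponent-preserved A i j Fpi≡pj)
    ...   | refl = Fpi≡pj

module Relabelling {k p} (dp : DistinctPrimes k p) (a : Fin k → ℕ) where
  open Divisors dp a

  module _ (π : Permutation k k) (a∘π : ∀ l → a (π ⟨$⟩ʳ l) ≡ a l) where

    relabelExp : Div n → Fin k → ℕ
    relabelExp x l = ν (π ⟨$⟩ʳ l) (val x)

    relabelExp-≤ : ∀ x l → relabelExp x l ≤ a l
    relabelExp-≤ x l = subst (relabelExp x l ≤_) (a∘π l) (ν-≤ (π ⟨$⟩ʳ l) (val x))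

    relabel : Div n → Div n
    relabel x = prodPow k p (relabelExp x) , prodPow-mono p (relabelExp-≤ x)

    ν-relabel : ∀ x l → ν l (val (relabel x)) ≡ ν (π ⟨$⟩ʳ l) (val x)
    ν-relabel x = ν-prodPow (relabelExp x) (relabelExp-≤ x)

    relabel-mono : ∀ x y → val x ∣ val y → val (relabel x) ∣ val (relabel y)
    relabel-mono x y x∣y = ν-reflects (proj₂ (relabel x))
      λ l → subst₂ _≤_ (sym (ν-relabel x l)) (sym (ν-relabel y l)) (ν-mono (π ⟨$⟩ʳ l) x∣y)

  relabel-cancel : ∀ π π' (a∘π : ∀ l → a (π ⟨$⟩ʳ l) ≡ a l) (a∘π' : ∀ l → a (π' ⟨$⟩ʳ l) ≡ a l) →
                   (∀ l → π ⟨$⟩ʳ (π' ⟨$⟩ʳ l) ≡ l) → ∀ x → val (relabel π' a∘π' (relabel π a∘π x)) ≡ val x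
  relabel-cancel π π' a∘π a∘π' ππ'≗id x = begin
    prodPow k p (λ l → ν (π' ⟨$⟩ʳ l) (val (relabel π a∘π x)))
      ≡⟨ prodPow-cong p (λ l → trans (ν-relabel π a∘π x (π' ⟨$⟩ʳ l)) (cong (λ i → ν i (val x)) (ππ'≗id l))) ⟩
    νPart (val x)
      ≡⟨ sym (factorisation (proj₂ x)) ⟩
    val x ∎
    where open ≡-Reasoning

  relabel-aut : (π : Permutation k k) → (∀ l → a (π ⟨$⟩ʳ l) ≡ a l) → Aut n
  relabel-aut π a∘π = record
    { F = relabel π a∘π ; F⁻¹ = relabel (flip π) a∘π⁻¹
    ; F⁻¹∘F = F⁻¹∘F
    ; F∘F⁻¹ = relabel-cancel (flip π) π a∘π⁻¹ a∘π (λ l → inverseˡ π)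
    ; F-mono = relabel-mono π a∘π
    ; F-reflect = λ x y Fx∣Fy → subst₂ _∣_ (F⁻¹∘F x) (F⁻¹∘F y)
                                   (relabel-mono (flip π) a∘π⁻¹ (relabel π a∘π x) (relabel π a∘π y) Fx∣Fy) }
    where
    a∘π⁻¹ : ∀ l → a (π ⟨$⟩ˡ l) ≡ a l
    a∘π⁻¹ l = trans (sym (a∘π (π ⟨$⟩ˡ l))) (cong a (inverseʳ π))
    F⁻¹∘F : ∀ x → val (relabel (flip π) a∘π⁻¹ (relabel π a∘π x)) ≡ val x
    F⁻¹∘F = relabel-cancel π (flip π) a∘π a∘π⁻¹ (λ l → inverseʳ π)

module Swapping {k p} (dp : DistinctPrimes k p) (a : Fin k → ℕ) (apos : ∀ i → 1 ≤ a i) where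
  open Divisors dp a
  open Relabelling dp a
  open Automorphisms dp a apos

  transpose-preserves : ∀ {i j} → a i ≡ a j → ∀ l → a (transpose i j ⟨$⟩ʳ l) ≡ a l
  transpose-preserves {i} {j} ai≡aj l with l Fin.≟ i
  ... | yes refl = sym ai≡aj
  ... | no _ with l Fin.≟ j
  ...   | yes refl = ai≡aj
  ...   | no _     = refl

  swap : ∀ {i j} → a i ≡ a j → Aut n
  swap {i} {j} ai≡aj = relabel-aut (transpose i j) (transpose-preserves ai≡aj)

  swap-moves : ∀ {i j} (ai≡aj : a i ≡ a j) → i ≢ j → val (Aut.F (swap ai≡aj) (atom j)) ≢ val (atom j)
  swap-moves {i} {j} ai≡aj i≢j σpj≡pj = i≢j (index-∣ dp pi∣pj)
    where
    σpj : Div n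
    σpj = Aut.F (swap ai≡aj) (atom j)
    τi≡j : transpose i j ⟨$⟩ʳ i ≡ j
    τi≡j with i Fin.≟ i
    ... | yes _   = refl
    ... | no i≢i = contradiction refl i≢i
    1≤νi : 1 ≤ ν i (val σpj)
    1≤νi = subst (1 ≤_) (sym (trans (ν-relabel (transpose i j) (transpose-preserves ai≡aj) (atom j) i)
                                    (cong (λ l → ν l (p j ^ 1)) τi≡j)))
                 (ν-max j 1 (proj₂ (atom j)) ∣-refl)
    pi∣pj : p i ∣ p j
    pi∣pj = subst₂ _∣_ (^-identityʳ (p i)) (trans σpj≡pj (^-identityʳ (p j)))
                   (∣-trans (^-mono-∣ (p i) 1≤νi) (ν-∣ i (val σpj)))

module Coloring {k p} (dp : DistinctPrimes k p) (a : Fin k → ℕ) (apos : ∀ i → 1 ≤ a i) where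
  open Divisors dp a
  open Automorphisms dp a apos

  prefix : ℕ → Fin k → ℕ
  prefix t l with toℕ l <? t
  ... | yes _ = 1
  ... | no  _ = 0

  prefix-≤ : ∀ t l → prefix t l ≤ a l
  prefix-≤ t l with toℕ l <? t
  ... | yes _ = apos l
  ... | no  _ = z≤n

  prefix-mono : ∀ {t t'} → t ≤ t' → ∀ l → prefix t l ≤ prefix t' l
  prefix-mono {t} {t'} t≤t' l with toℕ l <? t | toℕ l <? t'
  ... | yes _   | yes _    = ≤-refl
  ... | yes l<t | no  l≮t' = contradiction (<-≤-trans l<t t≤t') l≮t'
  ... | no  _   | _        = z≤n

  prefix-contains : ∀ {t l} → toℕ l < t → 1 ≤ prefix t l
  prefix-contains {t} {l} l<t with toℕ l <? t
  ... | yes _   = ≤-refl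
  ... | no  l≮t = contradiction l<t l≮t

  prefix-contains⁻¹ : ∀ {t l} → 1 ≤ prefix t l → toℕ l < t
  prefix-contains⁻¹ {t} {l} 1≤prefix with toℕ l <? t
  ... | yes l<t = l<t
  prefix-contains⁻¹ () | no _

  primorial : ℕ → Div n
  primorial t = prodPow k p (prefix t) , prodPow-mono p (prefix-≤ t)

  p∣primorial : ∀ {t l} → toℕ l < t → p l ^ 1 ∣ val (primorial t)
  p∣primorial {t} {l} l<t = ^∣prodPow p (prefix t) l (prefix-contains l<t)

  p∣primorial⁻¹ : ∀ {t l} → p l ^ 1 ∣ val (primorial t) → toℕ l < t
  p∣primorial⁻¹ {t} {l} pl∣c = prefix-contains⁻¹ (^∣prodPow⇒≤ dp (prefix t) l 1 pl∣c)

  Black : ℕ → Set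
  Black m = ∃ λ (t : Fin (suc k)) → m ≡ val (primorial (toℕ t))

  black? : ∀ m → Dec (Black m)
  black? m = Fin.any? (λ t → m ≟ val (primorial (toℕ t)))

  black-comparable : ∀ {u v} → Black u → Black v → u ∣ v ⊎ v ∣ u
  black-comparable (s , refl) (t , refl) with ≤-total (toℕ s) (toℕ t)
  ... | inj₁ s≤t = inj₁ (prodPow-mono p (prefix-mono s≤t))
  ... | inj₂ t≤s = inj₂ (prodPow-mono p (prefix-mono t≤s))

  χ : Coloring 2
  χ m with black? m
  ... | yes _ = suc zero
  ... | no  _ = zero

  χ-black : ∀ {m m'} → χ m ≡ χ m' → Black m → Black m'
  χ-black {m} {m'} χm≡χm' bm with black? m | black? m'
  ... | _      | yes bm' = bm'
  ... | no ¬bm | no _    = contradiction bm ¬bm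
  χ-black () _ | yes _ | no _

  module _ (A : Aut n) where
    open Aut A
    open AutProperties A

    -- An automorphism preserving blackness both ways fixes all primorials …
    fixes-black : (∀ x → Black (val x) → Black (val (F x))) → (∀ x → Black (val x) → Black (val (F⁻¹ x))) →
                  ∀ x → Black (val x) → val (F x) ≡ val x
    fixes-black = fixes-chain Black black-comparable

    -- … and then can only move p_i to some p_j with j ≤ i (look at the primorial p₁⋯p_{i+1}).
    atom-index-≤ : (∀ x → Black (val x) → val (F x) ≡ val x) →
                   ∀ {i j} → val (F (atom i)) ≡ p j ^ 1 → toℕ j ≤ toℕ i
    atom-index-≤ F-fixes-black {i} {j} Fpi≡pj = ≤-pred (p∣primorial⁻¹ pj∣c)
      where
      c : Div n
      c = primorial (suc (toℕ i))
      pj∣c : p j ^ 1 ∣ val c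
      pj∣c = subst₂ _∣_ Fpi≡pj (F-fixes-black c (suc i , refl)) (F-mono (atom i) c (p∣primorial ≤-refl))

  -- Applied to F and F⁻¹ this gives F(p_i) = p_i, so F is the identity by rigidity.
  χ-distinguishing : Distinguishing n 2 χ
  χ-distinguishing f f-aut χ-preserved = rigid A F-fixes-atoms
    where
    A : Aut n
    A = fromIsAut f f-aut
    open Aut A
    F-black : ∀ x → Black (val x) → Black (val (F x))
    F-black x = χ-black (sym (χ-preserved x))
    F⁻¹-black : ∀ x → Black (val x) → Black (val (F⁻¹ x))
    F⁻¹-black x = χ-black (trans (sym (cong χ (F∘F⁻¹ x))) (χ-preserved (F⁻¹ x)))
    F-fixes-atoms : ∀ i → val (F (atom i)) ≡ p i ^ 1
    F-fixes-atoms i with F-atom A i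
    ... | j , Fpi≡pj
      with Fin.toℕ-injective (≤-antisym
             (atom-index-≤ A (fixes-black A F-black F⁻¹-black) Fpi≡pj)
             (atom-index-≤ (inverse A) (fixes-black (inverse A) F⁻¹-black F-black)
                           (AutProperties.F⁻¹-image A (atom i) (atom j) Fpi≡pj)))
    ...   | refl = Fpi≡pj

collision : ∀ {k} (a : Fin k → ℕ) → ¬ (∀ i j → a i ≡ a j → i ≡ j) → ∃ λ i → ∃ λ j → a i ≡ a j × i ≢ j
collision {k} a ¬injective =
  let i , ¬separates-i  = Fin.¬∀⟶∃¬ k _ (λ i → Fin.all? (separates? i)) ¬injective
      j , ¬separates-ij = Fin.¬∀⟶∃¬ k _ (separates? i) ¬separates-i
  in  i , j , decidable-stable (a i ≟ a j) (λ ai≢aj → ¬separates-ij (λ ai≡aj → contradiction ai≡aj ai≢aj))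
            , λ i≡j → ¬separates-ij (λ _ → i≡j)
  where
  separates? : ∀ i j → Dec (a i ≡ a j → i ≡ j)
  separates? i j = (a i ≟ a j) →-dec (i Fin.≟ j)

colors-≥1 : ∀ {n c} → HasDistColoring n c → 1 ≤ c
colors-≥1 {c = zero}  (χ , _) with χ 0
... | ()
colors-≥1 {c = suc _} _ = s≤s z≤n

colors-≥2 : ∀ {n c} (A : Aut n) (x : Div n) → val (Aut.F A x) ≢ val x → HasDistColoring n c → 2 ≤ c
colors-≥2 {c = zero}        A x moved (χ , _) with χ 0
... | ()
colors-≥2 {c = 1}           A x moved (χ , χ-distinguishing) =
  contradiction (χ-distinguishing (Aut.F A) (toIsAut A) (λ y → one-color _ _) x) moved
  where
  one-color : ∀ (u v : Fin 1) → u ≡ v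
  one-color zero zero = refl
colors-≥2 {c = suc (suc _)} A x moved _ = s≤s (s≤s z≤n)

theorem3p12 : (n k : ℕ) (p a : Fin k → ℕ) → 1 < n →
    (∀ i → Prime (p i)) → (∀ i j → p i ≡ p j → i ≡ j) → (∀ i → 1 ≤ a i) →
    n ≡ prodFin k (λ i → p i ^ a i) →
    ((∀ i j → a i ≡ a j → i ≡ j) → DistNum n 1)
    × (¬ (∀ i j → a i ≡ a j → i ≡ j) → DistNum n 2)
theorem3p12 .(prodFin k (λ i → p i ^ a i)) k p a _ prime distinct apos refl = distinct-exponents , repeated-exponent
  where
  dp : DistinctPrimes k p
  dp = record { isPrime = prime ; injective = distinct }
  open Divisors dp a using (n)
  open Automorphisms dp a apos using (atom; distinct-exponents⇒rigid)
  open Swapping dp a apos using (swap; swap-moves)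
  open Coloring dp a apos using (χ; χ-distinguishing)

  distinct-exponents : (∀ i j → a i ≡ a j → i ≡ j) → DistNum n 1
  distinct-exponents a-injective =
    ((λ _ → zero) , λ f f-aut _ → distinct-exponents⇒rigid a-injective (fromIsAut f f-aut)) , λ _ → colors-≥1

  repeated-exponent : ¬ (∀ i j → a i ≡ a j → i ≡ j) → DistNum n 2
  repeated-exponent ¬a-injective with collision a ¬a-injective
  ... | i , j , ai≡aj , i≢j =
    (χ , χ-distinguishing) , λ _ → colors-≥2 (swap ai≡aj) (atom j) (swap-moves ai≡aj i≢j)
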